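{- Let $d\ge1$ and $a_1,\ldots,a_d,m$ be positive integers. If $(a_1,\ldots,a_d)\xrightarrow{\textsc{bm}} m$, then there exists a positive integer $a_{d+1}$ such that $(a_1,\ldots,a_d,a_{d+1})\xrightarrow{\textsc{bm}} m$.
   Context: A hypergraph is identified with its finite edge set; a matching is a set of pairwise disjoint edges. A hypergraph $H$ is $k$-partite with sides $V_1,\ldots,V_k$ (a fixed partition of its vertex set) if $|e\cap V_t|=1$ for every edge $e$ and every $t$. For $f:H\to\mathbb{R}_{\ge0}$, $\deg_f(v)=\sum_{e\ni v}f(e)$; $f$ is balanced if $\deg_f$ is constant on each side. $H$ is $(b_1,\ldots,b_k)$-fractionally balanced if it is $k$-partite with sides of sizes $b_1,\ldots,b_k$ and has a nonzero balanced $f:H\to\mathbb{R}_{\ge0}$. $(b_1,\ldots,b_k)\xrightarrow{\textsc{bm}} m$ means every $(b_1,\ldots,b_k)$-fractionally balanced $k$-partite hypergraph has a matching of size $m$.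
   Formalization: The nonzero balanced weights f witnessing fractional balance take values in the nonnegative rationals instead of the nonnegative reals. -}

module Defs where

open import Data.Nat as ℕ using (ℕ; suc)
open import Data.Fin using (Fin; _≟_)
open import Data.Fin.Properties using () renaming (_≟_ to _≟ᶠ_)
open import Data.Vec using (Vec; lookup)
open import Data.List using (List; length; map; foldr; allFin)
open import Data.List.Relation.Unary.AllPairs using (AllPairs)
open import Data.Rational as ℚ using (ℚ; 0ℚ; _+_; _≤_)
open import Data.Product using (Σ; ∃; _×_; _,_)
open import Data.Bool using (if_then_else_)
open import Relation.Nullary using (¬_)
open import Relation.Nullary.Decidable using (⌊_⌋)
open import Relation.Binary.PropositionalEquality using (_≡_; _≢_)

-- The vertex set is the disjoint union of the sides; a vertex is a pair (t , i).
-- An edge meets every side in exactly one vertex, so it is a choice function.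
Edge : {k : ℕ} → Vec ℕ k → Set
Edge {k} b = (t : Fin k) → Fin (lookup b t)

Disjoint : {k : ℕ} {b : Vec ℕ k} → Edge b → Edge b → Set
Disjoint {k} e e' = (t : Fin k) → e t ≢ e' t

Distinct : {k : ℕ} {b : Vec ℕ k} → Edge b → Edge b → Set
Distinct {k} e e' = Σ (Fin k) λ t → e t ≢ e' t

record Hypergraph {k : ℕ} (b : Vec ℕ k) : Set where
  constructor hypergraph
  field
    edges    : List (Edge b)
    distinct : AllPairs (Distinct {b = b}) edges
open Hypergraph public

edgeAt : {k : ℕ} {b : Vec ℕ k} (H : Hypergraph b) → Fin (length (edges H)) → Edge b
edgeAt H p = Data.List.lookup (edges H) p

sumℚ : List ℚ → ℚ
sumℚ = foldr _+_ 0ℚ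

Weight : {k : ℕ} {b : Vec ℕ k} → Hypergraph b → Set
Weight H = Fin (length (edges H)) → ℚ

deg : {k : ℕ} {b : Vec ℕ k} (H : Hypergraph b) → Weight H →
      (t : Fin k) → Fin (lookup b t) → ℚ
deg H f t v =
  sumℚ (map (λ p → if ⌊ edgeAt H p t ≟ᶠ v ⌋ then f p else 0ℚ) (allFin (length (edges H))))

Balanced : {k : ℕ} {b : Vec ℕ k} (H : Hypergraph b) → Weight H → Set
Balanced {k} {b} H f = (t : Fin k) (v w : Fin (lookup b t)) → deg H f t v ≡ deg H f t w

FractionallyBalanced : {k : ℕ} {b : Vec ℕ k} → Hypergraph b → Set
FractionallyBalanced H =
  Σ (Weight H) λ f →
    ((p : Fin (length (edges H))) → 0ℚ ≤ f p)
    × (Σ (Fin (length (edges H))) λ p → f p ≢ 0ℚ)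
    × Balanced H f

HasMatching : {k : ℕ} {b : Vec ℕ k} → Hypergraph b → ℕ → Set
HasMatching {b = b} H m =
  Σ (Fin m → Fin (length (edges H))) λ g →
    ((i j : Fin m) → i ≢ j → (g i ≢ g j) × Disjoint {b = b} (edgeAt H (g i)) (edgeAt H (g j)))

_→BM_ : {k : ℕ} → Vec ℕ k → ℕ → Set
_→BM_ b m = (H : Hypergraph b) → FractionallyBalanced H → HasMatching H m

Positive : {k : ℕ} → Vec ℕ k → Set
Positive {k} b = (t : Fin k) → 0 ℕ.< lookup b t

module Submission where

-- Let H be a hypergraph with sides a ∷ʳ N carrying a nonzero balanced weight f of mass W.
-- Balance on the new side gives all N new vertices the same degree c, so W = N·c.  Pushing f
-- forward along the map forgetting the new side gives a balanced weight g on the complete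
-- a-partite hypergraph, whose edges are indexed by Fin (∏ a).  Call such an edge u thick if at
-- least m distinct new vertices occur in edges of H above u.  Each thin edge carries g-weight
-- at most m·c, so the thin part y of g has mass at most ∏ a·m·c, and the thick part x = g − y
-- is nearly balanced: its degrees on a side differ by at most the mass of y.
--
-- Fourier–Motzkin elimination, applied to each of the finitely many sets B of edges, yields
-- one constant K such that every B either carries a balanced distribution or bounds the mass
-- of each weighting on B by K times its imbalance.  For N > (K+1)·∏ a·m the second case
-- would give W ≤ (K+1)·∏ a·m·c < N·c = W.  So the thick edges carry a balanced distribution,
-- hence (by a →BM m) a matching of size m, and as each thick edge has m distinct lifts these
-- can be chosen greedily with pairwise distinct new vertices.

open import Defs
open import Level using (0ℓ)
open import Algebra.Bundles using (Semiring; CommutativeRing; CommutativeMonoid)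
open import Data.Nat as ℕ using (ℕ; zero; suc)
import Data.Nat.Properties as ℕ
open import Data.Integer as ℤ using (+_; -[1+_]; ∣_∣)
import Data.Integer.Properties as ℤ
open import Data.Fin using (Fin; zero; suc; splitAt; remQuot; combine)
open import Data.Fin.Properties
  using (_≟_; any?; all?; ¬∀⟶∃¬; suc-injective; remQuot-combine; combine-remQuot)
open import Data.Fin.Subset using (Subset; _∈_; _∉_; inside; outside)
open import Data.Fin.Subset.Properties using (_∈?_)
open import Data.Rational as ℚ
  using (ℚ; mkℚ; 0ℚ; 1ℚ; _+_; _*_; -_; _-_; _≤_; _<_; toℚᵘ; 1/_; positive; nonNegative)
open import Data.Rational.Properties as ℚ hiding (_≟_)
open import Data.Rational.Solver using (module +-*-Solver)
import Data.Rational.Unnormalised as ℚᵘ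
import Data.Rational.Unnormalised.Properties as ℚᵘ
open import Data.Vec as Vec using (Vec; []; _∷_; _∷ʳ_)
import Data.Vec.Properties as Vec
open import Data.Vec.Functional using (Vector; _++_; head; tail)
  renaming (_∷_ to _∷ᵛ_; [] to []ᵛ)
open import Data.List as List using (List; _∷_; []; tabulate; concat; cartesianProductWith)
import Data.List.Properties as List
open import Data.List.Relation.Unary.All as All using (All; _∷_; [])
import Data.List.Relation.Unary.All.Properties as All
open import Data.List.Relation.Unary.AllPairs as AllPairs using ([]; _∷_)
import Data.List.Relation.Unary.AllPairs.Properties as AllPairs
open import Data.List.Relation.Unary.Unique.Propositional using (Unique)
import Data.List.Relation.Unary.Unique.Propositional.Properties as Unique
open import Data.List.Membership.Propositional using (find) renaming (_∈_ to _∈ˡ_)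
open import Data.List.Membership.Propositional.Properties
  using (∈-cartesianProductWith⁺; ∈-map⁺; ∈-map⁻; ∈-lookup)
import Data.List.Extrema
open import Data.Bool using (true; if_then_else_)
open import Data.Product using (Σ; ∃; ∃₂; _×_; _,_; proj₁; proj₂)
open import Data.Sum using (_⊎_; inj₁; inj₂; [_,_]′)
open import Data.Empty using (⊥-elim)
open import Function using (_∘_; id; _⇔_; mk⇔; Equivalence)
open import Function.Properties.Equivalence using () renaming (trans to ⇔-trans)
open import Relation.Nullary using (Dec; yes; no; ¬_; ¬?; does)
open import Relation.Nullary.Decidable using (⌊_⌋; _×-dec_)
open import Relation.Binary.Bundles using (DecTotalOrder)
open import Relation.Binary.Definitions using (tri<; tri≈; tri>)
open import Relation.Binary.PropositionalEquality

ℚ-semiring : Semiring 0ℓ 0ℓ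
ℚ-semiring = CommutativeRing.semiring +-*-commutativeRing

open import Algebra.Properties.Semiring.Sum ℚ-semiring
  using (sum; sum-syntax; sum-cong-≗; ∑-distrib-+; ∑-comm; *-distribˡ-sum; sum-replicate-zero; sum-replicate)
open import Algebra.Properties.Semiring.Mult ℚ-semiring using (×1-homo-*; ×-assoc-*) renaming (_×_ to _×ℕ_)
open import Algebra.Properties.CommutativeSemigroup (CommutativeMonoid.commutativeSemigroup *-1-commutativeMonoid)
  using (x∙yz≈y∙xz)
open +-*-Solver using (solve; _:+_; _:*_; :-_; _:-_; _:=_; con)
open Equivalence using (to; from)

private
  variable
    k l m n : ℕ
    P Q : Set
    s : Fin k → ℕ

ι : ℕ → ℚ
ι n = n ×ℕ 1ℚ

ι-nonneg : ∀ n → 0ℚ ≤ ι n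
ι-nonneg zero    = ≤-refl
ι-nonneg (suc n) = +-mono-≤ (<⇒≤ (positive⁻¹ 1ℚ)) (ι-nonneg n)

ι-mono : m ℕ.≤ n → ι m ≤ ι n
ι-mono {n = n} ℕ.z≤n       = ι-nonneg n
ι-mono         (ℕ.s≤s m≤n) = +-monoʳ-≤ 1ℚ (ι-mono m≤n)

ι-* : ∀ m n → ι (m ℕ.* n) ≡ ι m * ι n
ι-* = ×1-homo-*

ι-archimedean : ∀ q → ∃ λ n → q ≤ ι n
ι-archimedean (mkℚ k d _) =
  ∣ k ∣ , toℚᵘ-cancel-≤ (ℚᵘ.≤-respʳ-≃ (ℚᵘ.≃-sym (toℚᵘ-ι ∣ k ∣)) (ℚᵘ.*≤* k≤∣k∣*d))
  where
  toℚᵘ-ι : ∀ n → toℚᵘ (ι n) ℚᵘ.≃ ℚᵘ.mkℚᵘ (+ n) 0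
  toℚᵘ-ι zero    = ℚᵘ.*≡* refl
  toℚᵘ-ι (suc n) = ℚᵘ.≃-trans (toℚᵘ-homo-+ 1ℚ (ι n))
    (ℚᵘ.≃-trans (ℚᵘ.+-congʳ (toℚᵘ 1ℚ) (toℚᵘ-ι n)) (ℚᵘ.*≡* (cong (ℤ._* + 1) 1+n≡suc-n)))
    where
    1+n≡suc-n : + 1 ℤ.+ + n ℤ.* + 1 ≡ + suc n
    1+n≡suc-n = trans (cong (ℤ._+_ (+ 1)) (ℤ.*-identityʳ (+ n))) (sym (ℤ.pos-+ 1 n))
  i≤∣i∣ : ∀ i → i ℤ.≤ + ∣ i ∣
  i≤∣i∣ (+ n)    = ℤ.≤-refl
  i≤∣i∣ -[1+ n ] = ℤ.-≤+
  k≤∣k∣*d : k ℤ.* + 1 ℤ.≤ + ∣ k ∣ ℤ.* + suc d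
  k≤∣k∣*d = subst₂ ℤ._≤_ (sym (ℤ.*-identityʳ k)) (ℤ.pos-* ∣ k ∣ (suc d))
              (ℤ.≤-trans (i≤∣i∣ k) (ℤ.+≤+ (ℕ.m≤m*n ∣ k ∣ (suc d))))

*-nonneg : ∀ {p q} → 0ℚ ≤ p → 0ℚ ≤ q → 0ℚ ≤ p * q
*-nonneg {p} {q} 0≤p 0≤q =
  nonNegative⁻¹ _ {{nonNeg*nonNeg⇒nonNeg p {{nonNegative 0≤p}} q {{nonNegative 0≤q}}}}

*-monoˡ-≤-nonneg : ∀ {r p q} → 0ℚ ≤ r → p ≤ q → r * p ≤ r * q
*-monoˡ-≤-nonneg {r} 0≤r = *-monoˡ-≤-nonNeg r {{nonNegative 0≤r}}

≤∧≢⇒< : ∀ {p q} → p ≤ q → p ≢ q → p < q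
≤∧≢⇒< {p} {q} p≤q p≢q with <-cmp p q
... | tri< p<q _ _ = p<q
... | tri≈ _ p≡q _ = ⊥-elim (p≢q p≡q)
... | tri> _ _ p>q = ⊥-elim (<-irrefl refl (<-≤-trans p>q p≤q))

1+q≰q : ∀ q → ¬ (1ℚ + q ≤ q)
1+q≰q q 1+q≤q = <-irrefl refl (<-≤-trans (subst (_< 1ℚ + q) (+-identityˡ q) (+-monoˡ-< q (positive⁻¹ 1ℚ))) 1+q≤q)

inverse-pos : ∀ {h} → 0ℚ < h → ∃ λ r → 0ℚ < r × r * h ≡ 1ℚ
inverse-pos {h} 0<h = (1/ h) {{h≢0}} , positive⁻¹ _ {{1/pos⇒pos h {{positive 0<h}}}} , *-inverseˡ h {{h≢0}}
  where
  h≢0 : ℚ.NonZero h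
  h≢0 = pos⇒nonZero h {{positive 0<h}}

0≤-⇔ : ∀ {p q} → q ≤ p ⇔ 0ℚ ≤ p - q
0≤-⇔ {p} {q} = mk⇔
  (λ q≤p → ≤-trans (≤-reflexive (sym (+-inverseʳ q))) (+-monoˡ-≤ (- q) q≤p))
  (λ 0≤p-q → ≤-trans (≤-reflexive (sym (+-identityˡ q)))
               (≤-trans (+-monoˡ-≤ q 0≤p-q) (≤-reflexive (p-q+q≡p p q))))
  where
  p-q+q≡p : ∀ p q → p - q + q ≡ p
  p-q+q≡p = solve 2 (λ p q → p :- q :+ q := p) refl

0≤*⇔ : ∀ {r p} → 0ℚ < r → 0ℚ ≤ p ⇔ 0ℚ ≤ r * p
0≤*⇔ {r} 0<r = mk⇔
  (*-nonneg (<⇒≤ 0<r))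
  (λ 0≤rp → *-cancelˡ-≤-pos r {{positive 0<r}} (≤-trans (≤-reflexive (*-zeroʳ r)) 0≤rp))

scaled-difference-⇔ : ∀ {r p q s t} → 0ℚ < r → r * (p - q) ≡ t - s → q ≤ p ⇔ s ≤ t
scaled-difference-⇔ 0<r eq = mk⇔
  (λ q≤p → from 0≤-⇔ (subst (0ℚ ≤_) eq (to (0≤*⇔ 0<r) (to 0≤-⇔ q≤p))))
  (λ s≤t → from 0≤-⇔ (from (0≤*⇔ 0<r) (subst (0ℚ ≤_) (sym eq) (to 0≤-⇔ s≤t))))

difference-⇔ : ∀ {p q s t} → p - q ≡ t - s → q ≤ p ⇔ s ≤ t
difference-⇔ eq = scaled-difference-⇔ (positive⁻¹ 1ℚ) (trans (*-identityˡ _) eq)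

𝟙 : Dec P → ℚ
𝟙 P? = if does P? then 1ℚ else 0ℚ

𝟙-nonneg : (P? : Dec P) → 0ℚ ≤ 𝟙 P?
𝟙-nonneg (yes _) = <⇒≤ (positive⁻¹ 1ℚ)
𝟙-nonneg (no _)  = ≤-refl

𝟙-yes : (P? : Dec P) → P → 𝟙 P? ≡ 1ℚ
𝟙-yes (yes _) _ = refl
𝟙-yes (no ¬p) p = ⊥-elim (¬p p)

𝟙-no : (P? : Dec P) → ¬ P → 𝟙 P? ≡ 0ℚ
𝟙-no (yes p) ¬p = ⊥-elim (¬p p)
𝟙-no (no _)  _  = refl

𝟙*-≤ : (P? : Dec P) {q : ℚ} → 0ℚ ≤ q → 𝟙 P? * q ≤ q
𝟙*-≤ (yes _) {q} _   = ≤-reflexive (*-identityˡ q)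
𝟙*-≤ (no _)  {q} 0≤q = ≤-trans (≤-reflexive (*-zeroˡ q)) 0≤q

𝟙+𝟙¬ : (P? : Dec P) → 𝟙 P? + 𝟙 (¬? P?) ≡ 1ℚ
𝟙+𝟙¬ (yes _) = refl
𝟙+𝟙¬ (no _)  = refl

if-⌊⌋ : (P? : Dec P) (q : ℚ) → (if ⌊ P? ⌋ then q else 0ℚ) ≡ 𝟙 P? * q
if-⌊⌋ (yes _) q = sym (*-identityˡ q)
if-⌊⌋ (no _)  q = sym (*-zeroˡ q)

∑-mono-≤ : ∀ {f g : Vector ℚ n} → (∀ i → f i ≤ g i) → sum f ≤ sum g
∑-mono-≤ {zero}  f≤g = ≤-refl
∑-mono-≤ {suc n} f≤g = +-mono-≤ (f≤g zero) (∑-mono-≤ (f≤g ∘ suc))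

∑-zero : ∀ {f : Vector ℚ n} → (∀ i → f i ≡ 0ℚ) → sum f ≡ 0ℚ
∑-zero {n} f≡0 = trans (sum-cong-≗ f≡0) (sum-replicate-zero n)

∑-nonneg : ∀ {f : Vector ℚ n} → (∀ i → 0ℚ ≤ f i) → 0ℚ ≤ sum f
∑-nonneg {n} 0≤f = ≤-trans (≤-reflexive (sym (sum-replicate-zero n))) (∑-mono-≤ 0≤f)

≤-∑ : ∀ {f : Vector ℚ n} → (∀ i → 0ℚ ≤ f i) → ∀ i → f i ≤ sum f
≤-∑ {suc n} {f} 0≤f zero    =
  ≤-trans (≤-reflexive (sym (+-identityʳ (f zero)))) (+-monoʳ-≤ (f zero) (∑-nonneg (0≤f ∘ suc)))
≤-∑ {suc n} {f} 0≤f (suc i) =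
  ≤-trans (≤-∑ (0≤f ∘ suc) i) (≤-trans (≤-reflexive (sym (+-identityˡ _))) (+-monoˡ-≤ _ (0≤f zero)))

∑-pos : ∀ {f : Vector ℚ n} → (∀ i → 0ℚ ≤ f i) → ∀ i → f i ≢ 0ℚ → 0ℚ < sum f
∑-pos 0≤f i fᵢ≢0 = <-≤-trans (≤∧≢⇒< (0≤f i) (fᵢ≢0 ∘ sym)) (≤-∑ 0≤f i)

∑-≢0 : ∀ (f : Vector ℚ n) → sum f ≢ 0ℚ → ∃ λ i → f i ≢ 0ℚ
∑-≢0 {zero}  f ∑f≢0 = ⊥-elim (∑f≢0 refl)
∑-≢0 {suc n} f ∑f≢0 with f zero ℚ.≟ 0ℚ
... | no f₀≢0 = zero , f₀≢0
... | yes f₀≡0 with ∑-≢0 (f ∘ suc) (λ ∑≡0 → ∑f≢0 (trans (cong₂ _+_ f₀≡0 ∑≡0) (+-identityˡ 0ℚ)))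
...   | i , fᵢ≢0 = suc i , fᵢ≢0

∑-*ˡ : ∀ r (f : Vector ℚ n) → ∑[ i < n ] (r * f i) ≡ r * sum f
∑-*ˡ r f = sym (*-distribˡ-sum r f)

∑-const : ∀ n c → ∑[ i < n ] c ≡ ι n * c
∑-const n c = trans (sum-replicate n) (sym (trans (×-assoc-* n 1ℚ c) (cong (n ×ℕ_) (*-identityˡ c))))

∑-𝟙≟ : ∀ (i : Fin n) (f : Vector ℚ n) → ∑[ j < n ] (𝟙 (i ≟ j) * f j) ≡ f i
∑-𝟙≟ zero    f = trans (cong₂ _+_ (*-identityˡ (f zero)) (∑-zero (λ j → *-zeroˡ (f (suc j)))))
                       (+-identityʳ (f zero))
∑-𝟙≟ (suc i) f = trans (cong (_+ ∑[ j < _ ] (𝟙 (i ≟ j) * f (suc j))) (*-zeroˡ (f zero)))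
                       (trans (+-identityˡ _) (∑-𝟙≟ i (f ∘ suc)))

-- Fourier–Motzkin elimination

record Constraint (n : ℕ) : Set where
  constructor _≤ᶜ_
  field
    coeffs : Vector ℚ n
    bound  : ℚ
open Constraint

infix 7 _·_
_·_ : Vector ℚ n → Vector ℚ n → ℚ
c · x = ∑[ i < _ ] (c i * x i)

infix 4 _⊨_ _⊨*_
_⊨_ : Vector ℚ n → Constraint n → Set
x ⊨ κ = coeffs κ · x ≤ bound κ

_⊨*_ : Vector ℚ n → List (Constraint n) → Set
x ⊨* S = All (x ⊨_) S

slack : Constraint n → Vector ℚ n → ℚ
slack κ x = bound κ - coeffs κ · x

·-*ˡ : ∀ r (c x : Vector ℚ n) → (λ i → r * c i) · x ≡ r * (c · x)
·-*ˡ r c x = trans (sum-cong-≗ (λ i → *-assoc r (c i) (x i))) (∑-*ˡ r (λ i → c i * x i))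

·-+ : ∀ (c c′ x : Vector ℚ n) → (λ i → c i + c′ i) · x ≡ c · x + c′ · x
·-+ c c′ x = trans (sum-cong-≗ (λ i → *-distribʳ-+ (x i) (c i) (c′ i)))
                   (∑-distrib-+ (λ i → c i * x i) (λ i → c′ i * x i))

infixl 6 _+ᶜ_
_+ᶜ_ : Constraint n → Constraint n → Constraint n
κ +ᶜ κ′ = (λ i → coeffs κ i + coeffs κ′ i) ≤ᶜ (bound κ + bound κ′)

infixl 7 _*ᶜ_
_*ᶜ_ : ℚ → Constraint n → Constraint n
r *ᶜ κ = (λ i → r * coeffs κ i) ≤ᶜ (r * bound κ)

tailᶜ : Constraint (suc n) → Constraint n
tailᶜ κ = tail (coeffs κ) ≤ᶜ bound κ

slack-+ᶜ : ∀ (κ κ′ : Constraint n) x → slack (κ +ᶜ κ′) x ≡ slack κ x + slack κ′ x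
slack-+ᶜ κ κ′ x = trans (cong (_-_ (bound κ + bound κ′)) (·-+ (coeffs κ) (coeffs κ′) x))
                        (regroup (bound κ) (bound κ′) (coeffs κ · x) (coeffs κ′ · x))
  where
  regroup : ∀ b b′ d d′ → b + b′ - (d + d′) ≡ b - d + (b′ - d′)
  regroup = solve 4 (λ b b′ d d′ → b :+ b′ :- (d :+ d′) := b :- d :+ (b′ :- d′)) refl

slack-*ᶜ : ∀ r (κ : Constraint n) x → slack (r *ᶜ κ) x ≡ r * slack κ x
slack-*ᶜ r κ x = trans (cong (_-_ (r * bound κ)) (·-*ˡ r (coeffs κ) x)) (sym (distrib r (bound κ) _))
  where
  distrib : ∀ r b d → r * (b - d) ≡ r * b - r * d
  distrib = solve 3 (λ r b d → r :* (b :- d) := r :* b :- r :* d) refl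

-- Divided by the absolute value of its coefficient of x₀, a constraint on (x₀ ∷ y) either does
-- not involve x₀ or bounds x₀ from above or from below by an affine function of y.
data HeadBound (κ : Constraint (suc n)) : Set where
  free  : (κ′ : Constraint n) → (∀ x₀ y → (x₀ ∷ᵛ y) ⊨ κ ⇔ y ⊨ κ′) → HeadBound κ
  upper : (u : Constraint n) → (∀ x₀ y → (x₀ ∷ᵛ y) ⊨ κ ⇔ x₀ ≤ slack u y) → HeadBound κ
  lower : (l : Constraint n) → (∀ x₀ y → (x₀ ∷ᵛ y) ⊨ κ ⇔ - slack l y ≤ x₀) → HeadBound κ

headBound : (κ : Constraint (suc n)) → HeadBound κ
headBound κ@(c ≤ᶜ b) with <-cmp (c zero) 0ℚ
... | tri≈ _ h≡0 _ = free (tailᶜ κ) λ x₀ y → difference-⇔ (cong (_-_ b) (begin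
  c zero * x₀ + tail c · y ≡⟨ cong (λ h → h * x₀ + tail c · y) h≡0 ⟩
  0ℚ * x₀ + tail c · y     ≡⟨ cong (_+ tail c · y) (*-zeroˡ x₀) ⟩
  0ℚ + tail c · y          ≡⟨ +-identityˡ _ ⟩
  tail c · y               ∎))
  where open ≡-Reasoning
... | tri> _ _ h>0 =
  let r , r>0 , rh≡1 = inverse-pos h>0 in
  upper (r *ᶜ tailᶜ κ) λ x₀ y → scaled-difference-⇔ r>0 (begin
    r * (b - (c zero * x₀ + tail c · y))   ≡⟨ scale-split r b (c zero) x₀ (tail c · y) ⟩
    r * (b - tail c · y) - r * c zero * x₀ ≡⟨ cong₂ _-_ (sym (slack-*ᶜ r (tailᶜ κ) y)) (cong (_* x₀) rh≡1) ⟩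
    slack (r *ᶜ tailᶜ κ) y - 1ℚ * x₀      ≡⟨ cong (_-_ (slack (r *ᶜ tailᶜ κ) y)) (*-identityˡ x₀) ⟩
    slack (r *ᶜ tailᶜ κ) y - x₀           ∎)
  where
  open ≡-Reasoning
  scale-split : ∀ r b h x d → r * (b - (h * x + d)) ≡ r * (b - d) - r * h * x
  scale-split = solve 5 (λ r b h x d → r :* (b :- (h :* x :+ d)) := r :* (b :- d) :- r :* h :* x) refl
... | tri< h<0 _ _ =
  let r , r>0 , r[-h]≡1 = inverse-pos (neg-antimono-< h<0) in
  lower (r *ᶜ tailᶜ κ) λ x₀ y → scaled-difference-⇔ r>0 (begin
    r * (b - (c zero * x₀ + tail c · y))   ≡⟨ scale-split r b (c zero) x₀ (tail c · y) ⟩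
    r * (b - tail c · y) - r * c zero * x₀ ≡⟨ cong₂ _-_ (sym (slack-*ᶜ r (tailᶜ κ) y))
                                                        (cong (_* x₀) (trans (*-neg r (c zero)) (cong -_ r[-h]≡1))) ⟩
    slack (r *ᶜ tailᶜ κ) y - (- 1ℚ) * x₀   ≡⟨ minus-neg (slack (r *ᶜ tailᶜ κ) y) x₀ ⟩
    x₀ - - slack (r *ᶜ tailᶜ κ) y          ∎)
  where
  open ≡-Reasoning
  scale-split : ∀ r b h x d → r * (b - (h * x + d)) ≡ r * (b - d) - r * h * x
  scale-split = solve 5 (λ r b h x d → r :* (b :- (h :* x :+ d)) := r :* (b :- d) :- r :* h :* x) refl
  *-neg : ∀ r h → r * h ≡ - (r * - h)
  *-neg = solve 2 (λ r h → r :* h := :- (r :* (:- h))) refl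
  minus-neg : ∀ s x → s - (- 1ℚ) * x ≡ x - - s
  minus-neg = solve 2 (λ s x → s :- (:- con 1ℚ) :* x := x :- (:- s)) refl

record Split (n : ℕ) : Set where
  constructor split
  field
    frees uppers lowers : List (Constraint n)
open Split

Within : Split n → ℚ → Vector ℚ n → Set
Within s x₀ y = y ⊨* frees s × All (λ u → x₀ ≤ slack u y) (uppers s) × All (λ l → - slack l y ≤ x₀) (lowers s)

splitHead : List (Constraint (suc n)) → Split n
splitHead []      = split [] [] []
splitHead (κ ∷ S) with headBound κ | splitHead S
... | free κ′ _ | split F U L = split (κ′ ∷ F) U L
... | upper u _ | split F U L = split F (u ∷ U) L
... | lower l _ | split F U L = split F U (l ∷ L)

splitHead-⇔ : ∀ S x₀ (y : Vector ℚ n) → (x₀ ∷ᵛ y) ⊨* S ⇔ Within (splitHead S) x₀ y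
splitHead-⇔ []      x₀ y = mk⇔ (λ _ → [] , [] , []) (λ _ → [])
splitHead-⇔ (κ ∷ S) x₀ y with headBound κ | splitHead S | splitHead-⇔ S x₀ y
... | free κ′ κ⇔ | split F U L | ih = mk⇔
  (λ { (sκ ∷ sS) → let f , u , l = to ih sS in to (κ⇔ x₀ y) sκ ∷ f , u , l })
  (λ { (fκ ∷ f , u , l) → from (κ⇔ x₀ y) fκ ∷ from ih (f , u , l) })
... | upper u′ κ⇔ | split F U L | ih = mk⇔
  (λ { (sκ ∷ sS) → let f , u , l = to ih sS in f , to (κ⇔ x₀ y) sκ ∷ u , l })
  (λ { (f , uκ ∷ u , l) → from (κ⇔ x₀ y) uκ ∷ from ih (f , u , l) })
... | lower l′ κ⇔ | split F U L | ih = mk⇔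
  (λ { (sκ ∷ sS) → let f , u , l = to ih sS in f , u , to (κ⇔ x₀ y) sκ ∷ l })
  (λ { (f , u , lκ ∷ l) → from (κ⇔ x₀ y) lκ ∷ from ih (f , u , l) })

+ᶜ-⇔ : ∀ (u l : Constraint n) y → y ⊨ u +ᶜ l ⇔ - slack l y ≤ slack u y
+ᶜ-⇔ u l y = difference-⇔ (trans (slack-+ᶜ u l y) (a+b≡a--b (slack u y) (slack l y)))
  where
  a+b≡a--b : ∀ a b → a + b ≡ a - - b
  a+b≡a--b = solve 2 (λ a b → a :+ b := a :- (:- b)) refl

module _ where
  open Data.List.Extrema (DecTotalOrder.totalOrder ≤-decTotalOrder)

  between : ∀ {A B : Set} (lo : A → ℚ) (hi : B → ℚ) (L : List A) (U : List B) →
            (∀ {l u} → l ∈ˡ L → u ∈ˡ U → lo l ≤ hi u) →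
            ∃ λ x → All (λ l → lo l ≤ x) L × All (λ u → x ≤ hi u) U
  between lo hi L U lo≤hi = x , All.map⁻ (xs≤max _ (List.map lo L)) , All.tabulate x≤hi
    where
    x : ℚ
    x = max (min 0ℚ (List.map hi U)) (List.map lo L)
    x≤hi : ∀ {u} → u ∈ˡ U → x ≤ hi u
    x≤hi u∈U = max≤v⁺ (All.lookup (min≤xs 0ℚ (List.map hi U)) (∈-map⁺ hi u∈U))
                      (All.map⁺ (All.tabulate (λ l∈L → lo≤hi l∈L u∈U)))

eliminateHead : List (Constraint (suc n)) → List (Constraint n)
eliminateHead S = frees (splitHead S) List.++ cartesianProductWith _+ᶜ_ (uppers (splitHead S)) (lowers (splitHead S))

eliminateHead-sound : ∀ S x₀ (y : Vector ℚ n) → (x₀ ∷ᵛ y) ⊨* S → y ⊨* eliminateHead S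
eliminateHead-sound S x₀ y sat =
  let f , u , l = to (splitHead-⇔ S x₀ y) sat in
  All.++⁺ f (All.cartesianProductWith⁺ (setoid _) (setoid _) _+ᶜ_ _ _
    λ {u′} {l′} u′∈U l′∈L → from (+ᶜ-⇔ u′ l′ y) (≤-trans (All.lookup l l′∈L) (All.lookup u u′∈U)))

eliminateHead-complete : ∀ S (y : Vector ℚ n) → y ⊨* eliminateHead S → ∃ λ x₀ → (x₀ ∷ᵛ y) ⊨* S
eliminateHead-complete S y sat =
  let f , pairs = All.++⁻ (frees (splitHead S)) sat
      x₀ , lo≤x₀ , x₀≤hi = between (λ l → - slack l y) (λ u → slack u y) (lowers (splitHead S)) (uppers (splitHead S))
        λ {l} {u} l∈L u∈U → to (+ᶜ-⇔ u l y) (All.lookup pairs (∈-cartesianProductWith⁺ _+ᶜ_ u∈U l∈L))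
  in x₀ , from (splitHead-⇔ S x₀ y) (f , x₀≤hi , lo≤x₀)

eliminate : ∀ m → List (Constraint (m ℕ.+ n)) → List (Constraint n)
eliminate zero    S = S
eliminate (suc m) S = eliminate m (eliminateHead S)

⊨*-cong : ∀ {x x′ : Vector ℚ n} → (∀ i → x i ≡ x′ i) → ∀ {S} → x ⊨* S → x′ ⊨* S
⊨*-cong x≗x′ = All.map λ {κ} → subst (_≤ bound κ) (sum-cong-≗ λ i → cong (coeffs κ i *_) (x≗x′ i))

++-∷ᵛ : ∀ (x : Vector ℚ (suc m)) (y : Vector ℚ n) i → (x ++ y) i ≡ (head x ∷ᵛ (tail x ++ y)) i
++-∷ᵛ         x y zero    = refl
++-∷ᵛ {m = m} x y (suc i) with splitAt m i
... | inj₁ _ = refl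
... | inj₂ _ = refl

eliminate-sound : ∀ m S (x : Vector ℚ m) (y : Vector ℚ n) → (x ++ y) ⊨* S → y ⊨* eliminate m S
eliminate-sound zero    S x y sat = sat
eliminate-sound (suc m) S x y sat =
  eliminate-sound m (eliminateHead S) (tail x) y
    (eliminateHead-sound S (head x) (tail x ++ y) (⊨*-cong (++-∷ᵛ x y) sat))

eliminate-complete : ∀ m S (y : Vector ℚ n) → y ⊨* eliminate m S → ∃ λ (x : Vector ℚ m) → (x ++ y) ⊨* S
eliminate-complete zero    S y sat = []ᵛ , sat
eliminate-complete (suc m) S y sat =
  let x , sat′ = eliminate-complete m (eliminateHead S) y sat
      x₀ , sat″ = eliminateHead-complete S (x ++ y) sat′
  in x₀ ∷ᵛ x , ⊨*-cong (λ i → sym (++-∷ᵛ (x₀ ∷ᵛ x) y i)) sat″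

[_]ᵛ : ℚ → Vector ℚ 1
[ δ ]ᵛ = δ ∷ᵛ []ᵛ

origin-feasible-or-bounded : (S : List (Constraint 1)) →
  [ 0ℚ ]ᵛ ⊨* S ⊎ ∃₂ λ α β → β < 0ℚ × ∀ δ → [ δ ]ᵛ ⊨* S → α * δ ≤ β
origin-feasible-or-bounded S with All.all? (λ κ → coeffs κ · [ 0ℚ ]ᵛ ≤? bound κ) S
... | yes sat = inj₁ sat
... | no ¬sat =
  let κ , κ∈S , violated = find (All.¬All⇒Any¬ (λ κ → coeffs κ · [ 0ℚ ]ᵛ ≤? bound κ) S ¬sat)
      at-origin = trans (+-identityʳ _) (*-zeroʳ (coeffs κ zero))
  in inj₂ (coeffs κ zero , bound κ , <-≤-trans (≰⇒> violated) (≤-reflexive at-origin) ,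
           λ δ sat → ≤-trans (≤-reflexive (sym (+-identityʳ _))) (All.lookup sat κ∈S))

feasible-or-bounded : (S : List (Constraint (n ℕ.+ 1))) →
  (∃ λ x → (x ++ [ 0ℚ ]ᵛ) ⊨* S) ⊎ (∃₂ λ α β → β < 0ℚ × ∀ x δ → (x ++ [ δ ]ᵛ) ⊨* S → α * δ ≤ β)
feasible-or-bounded {n} S with origin-feasible-or-bounded (eliminate n S)
... | inj₁ sat                     = inj₁ (eliminate-complete n S [ 0ℚ ]ᵛ sat)
... | inj₂ (α , β , β<0 , bounded) = inj₂ (α , β , β<0 , λ x δ sat → bounded δ (eliminate-sound n S x [ δ ]ᵛ sat))

load : (Fin n → Fin m) → Vector ℚ n → Vector ℚ m
load φ x v = ∑[ p < _ ] (𝟙 (φ p ≟ v) * x p)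

load-nonneg : ∀ (φ : Fin n → Fin m) {x} → (∀ p → 0ℚ ≤ x p) → ∀ v → 0ℚ ≤ load φ x v
load-nonneg φ 0≤x v = ∑-nonneg λ p → *-nonneg (𝟙-nonneg (φ p ≟ v)) (0≤x p)

load-≤-∑ : ∀ (φ : Fin n → Fin m) {x} → (∀ p → 0ℚ ≤ x p) → ∀ v → load φ x v ≤ sum x
load-≤-∑ φ 0≤x v = ∑-mono-≤ λ p → 𝟙*-≤ (φ p ≟ v) (0≤x p)

load-cong : ∀ {φ ψ : Fin n → Fin m} → (∀ p → φ p ≡ ψ p) → ∀ x v → load φ x v ≡ load ψ x v
load-cong φ≗ψ x v = sum-cong-≗ λ p → cong (λ u → 𝟙 (u ≟ v) * x p) (φ≗ψ p)

load-+ : ∀ (φ : Fin n → Fin m) x y v → load φ (λ p → x p + y p) v ≡ load φ x v + load φ y v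
load-+ φ x y v = trans (sum-cong-≗ λ p → *-distribˡ-+ (𝟙 (φ p ≟ v)) (x p) (y p))
                       (∑-distrib-+ (λ p → 𝟙 (φ p ≟ v) * x p) (λ p → 𝟙 (φ p ≟ v) * y p))

load-*ˡ : ∀ (φ : Fin n → Fin m) r x v → load φ (λ p → r * x p) v ≡ r * load φ x v
load-*ˡ φ r x v = trans (sum-cong-≗ λ p → x∙yz≈y∙xz (𝟙 (φ p ≟ v)) r (x p)) (∑-*ˡ r (λ p → 𝟙 (φ p ≟ v) * x p))

∑-load : ∀ (φ : Fin n → Fin m) x → ∑[ v < m ] load φ x v ≡ sum x
∑-load φ x = trans (∑-comm (λ v p → 𝟙 (φ p ≟ v) * x p)) (sum-cong-≗ λ p → ∑-𝟙≟ (φ p) (λ _ → x p))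

load-∘ : ∀ (φ : Fin n → Fin m) (ψ : Fin m → Fin l) x w → load ψ (load φ x) w ≡ load (ψ ∘ φ) x w
load-∘ φ ψ x w = begin
  ∑[ u < _ ] (𝟙 (ψ u ≟ w) * ∑[ p < _ ] (𝟙 (φ p ≟ u) * x p))
    ≡⟨ sum-cong-≗ (λ u → sym (∑-*ˡ (𝟙 (ψ u ≟ w)) (λ p → 𝟙 (φ p ≟ u) * x p))) ⟩
  ∑[ u < _ ] ∑[ p < _ ] (𝟙 (ψ u ≟ w) * (𝟙 (φ p ≟ u) * x p))
    ≡⟨ ∑-comm (λ u p → 𝟙 (ψ u ≟ w) * (𝟙 (φ p ≟ u) * x p)) ⟩
  ∑[ p < _ ] ∑[ u < _ ] (𝟙 (ψ u ≟ w) * (𝟙 (φ p ≟ u) * x p))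
    ≡⟨ sum-cong-≗ (λ p → sum-cong-≗ λ u → x∙yz≈y∙xz (𝟙 (ψ u ≟ w)) (𝟙 (φ p ≟ u)) (x p)) ⟩
  ∑[ p < _ ] ∑[ u < _ ] (𝟙 (φ p ≟ u) * (𝟙 (ψ u ≟ w) * x p))
    ≡⟨ sum-cong-≗ (λ p → ∑-𝟙≟ (φ p) (λ u → 𝟙 (ψ u ≟ w) * x p)) ⟩
  ∑[ p < _ ] (𝟙 (ψ (φ p) ≟ w) * x p)
    ∎
  where open ≡-Reasoning

-- Edge with the side sizes given by a function instead of a vector: unlike lookup b, a function
-- is recovered by unification, so families of such edges need no explicit side-size argument.
Edgeᶠ : (Fin k → ℕ) → Set
Edgeᶠ {k} s = (t : Fin k) → Fin (s t)

degree : (E : Fin n → Edgeᶠ s) → Vector ℚ n → (t : Fin k) → Vector ℚ (s t)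
degree E x t = load (λ p → E p t) x

IsBalanced : (E : Fin n → Edgeᶠ s) → Vector ℚ n → Set
IsBalanced E x = ∀ t v w → degree E x t v ≡ degree E x t w

ImbalanceAtMost : (E : Fin n → Edgeᶠ s) → Vector ℚ n → ℚ → Set
ImbalanceAtMost E x δ = ∀ t v w → degree E x t v ≤ degree E x t w + δ

record WeightingOn (B : Subset n) (x : Vector ℚ n) : Set where
  field
    nonneg      : ∀ u → 0ℚ ≤ x u
    off-support : ∀ u → u ∉ B → x u ≡ 0ℚ
open WeightingOn

imbalanceAtMost-0⇒balanced : ∀ {E : Fin n → Edgeᶠ s} {x} → ImbalanceAtMost E x 0ℚ → IsBalanced E x
imbalanceAtMost-0⇒balanced imb t v w =
  ≤-antisym (≤-trans (imb t v w) (≤-reflexive (+-identityʳ _)))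
            (≤-trans (imb t w v) (≤-reflexive (+-identityʳ _)))

imbalance-of-part : ∀ {E : Fin n → Edgeᶠ s} {g x y} → (∀ u → g u ≡ x u + y u) → (∀ u → 0ℚ ≤ y u) →
                    IsBalanced E g → ImbalanceAtMost E x (sum y)
imbalance-of-part {E = E} {g} {x} {y} g≡x+y 0≤y bal t v w = begin
  degree E x t v                    ≤⟨ ≤-trans (≤-reflexive (sym (+-identityʳ _)))
                                               (+-monoʳ-≤ (degree E x t v) (load-nonneg (λ p → E p t) 0≤y v)) ⟩
  degree E x t v + degree E y t v   ≡⟨ sym (additive v) ⟩
  degree E g t v                    ≡⟨ bal t v w ⟩
  degree E g t w                    ≡⟨ additive w ⟩
  degree E x t w + degree E y t w   ≤⟨ +-monoʳ-≤ (degree E x t w) (load-≤-∑ (λ p → E p t) 0≤y w) ⟩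
  degree E x t w + sum y            ∎
  where
  open ≤-Reasoning
  additive : ∀ v → degree E g t v ≡ degree E x t v + degree E y t v
  additive v = trans (sum-cong-≗ λ p → cong (𝟙 (E p t ≟ v) *_) (g≡x+y p)) (load-+ (λ p → E p t) x y v)

-- Balanced distributions versus robust imbalance

·-++ : ∀ (c x : Vector ℚ m) (c′ x′ : Vector ℚ n) → (c ++ c′) · (x ++ x′) ≡ c · x + c′ · x′
·-++ {m = zero}  c x c′ x′ = sym (+-identityˡ _)
·-++ {m = suc m} c x c′ x′ = begin
  (c ++ c′) · (x ++ x′)                               ≡⟨ sum-cong-≗ (λ i → cong₂ _*_ (++-∷ᵛ c c′ i) (++-∷ᵛ x x′ i)) ⟩
  c zero * x zero + (tail c ++ c′) · (tail x ++ x′)   ≡⟨ cong (_+_ (c zero * x zero)) (·-++ (tail c) (tail x) c′ x′) ⟩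
  c zero * x zero + (tail c · tail x + c′ · x′)       ≡⟨ sym (+-assoc (c zero * x zero) (tail c · tail x) (c′ · x′)) ⟩
  c · x + c′ · x′                                     ∎
  where open ≡-Reasoning

𝕖 : Fin n → Vector ℚ n
𝕖 u w = 𝟙 (u ≟ w)

𝕖-· : ∀ (u : Fin n) x → 𝕖 u · x ≡ x u
𝕖-· = ∑-𝟙≟

-- The unknowns are x ++ [ δ ]ᵛ; a solution is a weighting x supported in B, of mass at least 1,
-- whose degrees on each side differ by at most δ.
module NearBalanceSystem (E : Fin n → Edgeᶠ s) (B : Subset n) where

  constraint : Vector ℚ n → ℚ → ℚ → Constraint (n ℕ.+ 1)
  constraint c cδ β = (c ++ [ cδ ]ᵛ) ≤ᶜ β

  ⊨-constraint : ∀ {x δ} c cδ β {d} → c · x ≡ d → (x ++ [ δ ]ᵛ) ⊨ constraint c cδ β ⇔ d + cδ * δ ≤ β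
  ⊨-constraint {x} {δ} c cδ β {d} c·x≡d = mk⇔ (subst (_≤ β) eq) (subst (_≤ β) (sym eq))
    where
    eq : (c ++ [ cδ ]ᵛ) · (x ++ [ δ ]ᵛ) ≡ d + cδ * δ
    eq = trans (·-++ c x [ cδ ]ᵛ [ δ ]ᵛ) (cong₂ _+_ c·x≡d (+-identityʳ (cδ * δ)))

  nonnegᶜ : Fin n → Constraint (n ℕ.+ 1)
  nonnegᶜ u = constraint (λ w → - 1ℚ * 𝕖 u w) 0ℚ 0ℚ

  offSupportᶜ : Fin n → Constraint (n ℕ.+ 1)
  offSupportᶜ u = constraint (λ w → 𝟙 (¬? (u ∈? B)) * 𝕖 u w) 0ℚ 0ℚ

  massᶜ : Constraint (n ℕ.+ 1)
  massᶜ = constraint (λ _ → - 1ℚ) 0ℚ (- 1ℚ)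

  imbalanceᶜ : (t : Fin _) → Fin (s t) → Fin (s t) → Constraint (n ℕ.+ 1)
  imbalanceᶜ t v w = constraint (λ u → 𝟙 (E u t ≟ v) + - 1ℚ * 𝟙 (E u t ≟ w)) (- 1ℚ) 0ℚ

  module _ {x : Vector ℚ n} {δ : ℚ} where

    nonnegᶜ-⇔ : ∀ u → (x ++ [ δ ]ᵛ) ⊨ nonnegᶜ u ⇔ 0ℚ ≤ x u
    nonnegᶜ-⇔ u = ⇔-trans (⊨-constraint _ 0ℚ 0ℚ (trans (·-*ˡ (- 1ℚ) (𝕖 u) x) (cong (- 1ℚ *_) (𝕖-· u x))))
                          (difference-⇔ (rearrange (x u) δ))
      where
      rearrange : ∀ a δ → 0ℚ - (- 1ℚ * a + 0ℚ * δ) ≡ a - 0ℚ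
      rearrange = solve 2 (λ a δ → con 0ℚ :- (:- con 1ℚ :* a :+ con 0ℚ :* δ) := a :- con 0ℚ) refl

    offSupportᶜ-⇔ : ∀ u → (x ++ [ δ ]ᵛ) ⊨ offSupportᶜ u ⇔ 𝟙 (¬? (u ∈? B)) * x u ≤ 0ℚ
    offSupportᶜ-⇔ u = ⇔-trans (⊨-constraint _ 0ℚ 0ℚ (trans (·-*ˡ o (𝕖 u) x) (cong (o *_) (𝕖-· u x))))
                              (difference-⇔ (rearrange (o * x u) δ))
      where
      o : ℚ
      o = 𝟙 (¬? (u ∈? B))
      rearrange : ∀ a δ → 0ℚ - (a + 0ℚ * δ) ≡ 0ℚ - a
      rearrange = solve 2 (λ a δ → con 0ℚ :- (a :+ con 0ℚ :* δ) := con 0ℚ :- a) refl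

    massᶜ-⇔ : (x ++ [ δ ]ᵛ) ⊨ massᶜ ⇔ 1ℚ ≤ sum x
    massᶜ-⇔ = ⇔-trans (⊨-constraint _ 0ℚ (- 1ℚ) (∑-*ˡ (- 1ℚ) x)) (difference-⇔ (rearrange (sum x) δ))
      where
      rearrange : ∀ a δ → - 1ℚ - (- 1ℚ * a + 0ℚ * δ) ≡ a - 1ℚ
      rearrange = solve 2 (λ a δ → :- con 1ℚ :- (:- con 1ℚ :* a :+ con 0ℚ :* δ) := a :- con 1ℚ) refl

    imbalanceᶜ-⇔ : ∀ t v w → (x ++ [ δ ]ᵛ) ⊨ imbalanceᶜ t v w ⇔ degree E x t v ≤ degree E x t w + δ
    imbalanceᶜ-⇔ t v w =
      ⇔-trans (⊨-constraint _ (- 1ℚ) 0ℚ (trans (·-+ (λ u → 𝟙 (E u t ≟ v)) (λ u → - 1ℚ * 𝟙 (E u t ≟ w)) x)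
                                               (cong (_+_ (degree E x t v)) (·-*ˡ (- 1ℚ) (λ u → 𝟙 (E u t ≟ w)) x))))
              (difference-⇔ (rearrange (degree E x t v) (degree E x t w) δ))
      where
      rearrange : ∀ a b δ → 0ℚ - (a + - 1ℚ * b + - 1ℚ * δ) ≡ b + δ - a
      rearrange = solve 3 (λ a b δ → con 0ℚ :- (a :+ :- con 1ℚ :* b :+ :- con 1ℚ :* δ) := b :+ δ :- a) refl

  system : List (Constraint (n ℕ.+ 1))
  system = tabulate nonnegᶜ List.++ tabulate offSupportᶜ List.++ massᶜ ∷
           concat (tabulate λ t → concat (tabulate λ v → tabulate (imbalanceᶜ t v)))

  system-⇔ : ∀ {x δ} → (x ++ [ δ ]ᵛ) ⊨* system ⇔ (WeightingOn B x × 1ℚ ≤ sum x × ImbalanceAtMost E x δ)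
  system-⇔ {x} {δ} = mk⇔ complete sound
    where
    complete : (x ++ [ δ ]ᵛ) ⊨* system → WeightingOn B x × 1ℚ ≤ sum x × ImbalanceAtMost E x δ
    complete sat =
      let s-nonneg , rest = All.++⁻ (tabulate nonnegᶜ) sat
          s-off , s-rest = All.++⁻ (tabulate offSupportᶜ) rest
          x≥0 = λ u → to (nonnegᶜ-⇔ u) (All.tabulate⁻ s-nonneg u)
          x≤0 = λ u u∉B → ≤-trans (≤-reflexive (trans (sym (*-identityˡ (x u)))
                                                       (cong (_* x u) (sym (𝟙-yes (¬? (u ∈? B)) u∉B)))))
                                  (to (offSupportᶜ-⇔ u) (All.tabulate⁻ s-off u))
      in record { nonneg = x≥0 ; off-support = λ u u∉B → ≤-antisym (x≤0 u u∉B) (x≥0 u) } ,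
         to massᶜ-⇔ (All.head s-rest) ,
         λ t v w → to (imbalanceᶜ-⇔ t v w)
           (All.tabulate⁻ (All.tabulate⁻ (All.concat⁻ (All.tabulate⁻ (All.concat⁻ (All.tail s-rest)) t)) v) w)
    sound : WeightingOn B x × 1ℚ ≤ sum x × ImbalanceAtMost E x δ → (x ++ [ δ ]ᵛ) ⊨* system
    sound (wx , mass , imb) =
      All.++⁺ (All.tabulate⁺ λ u → from (nonnegᶜ-⇔ u) (nonneg wx u))
      (All.++⁺ (All.tabulate⁺ λ u → from (offSupportᶜ-⇔ u) (off u (u ∈? B)))
      (from massᶜ-⇔ mass ∷ All.concat⁺ (All.tabulate⁺ λ t → All.concat⁺ (All.tabulate⁺ λ v →
        All.tabulate⁺ λ w → from (imbalanceᶜ-⇔ t v w) (imb t v w)))))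
      where
      off : ∀ u (u∈?B : Dec (u ∈ B)) → 𝟙 (¬? u∈?B) * x u ≤ 0ℚ
      off u (yes _)  = ≤-reflexive (*-zeroˡ (x u))
      off u (no u∉B) = ≤-reflexive (trans (cong (1ℚ *_) (off-support wx u u∉B)) (*-zeroʳ 1ℚ))

BalancedDistributionOn : (E : Fin n → Edgeᶠ s) → Subset n → Set
BalancedDistributionOn E B = ∃ λ z → WeightingOn B z × 1ℚ ≤ sum z × IsBalanced E z

RobustlyUnbalanced : (E : Fin n → Edgeᶠ s) → Subset n → ℕ → Set
RobustlyUnbalanced E B K =
  ∀ x η → WeightingOn B x → 0ℚ ≤ η → ImbalanceAtMost E x η → sum x ≤ ι K * η

RobustlyUnbalanced-mono : ∀ {E : Fin n → Edgeᶠ s} {B K K′} → K ℕ.≤ K′ →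
                          RobustlyUnbalanced E B K → RobustlyUnbalanced E B K′
RobustlyUnbalanced-mono K≤K′ robust x η wx η≥0 imb =
  ≤-trans (robust x η wx η≥0 imb) (*-monoʳ-≤-nonNeg η {{nonNegative η≥0}} (ι-mono K≤K′))

module _ {E : Fin n → Edgeᶠ s} {B : Subset n} {α β : ℚ}
         (bounded : ∀ x δ → WeightingOn B x → 1ℚ ≤ sum x → ImbalanceAtMost E x δ → α * δ ≤ β) where

  normalised-bound : ∀ {x η} → WeightingOn B x → ImbalanceAtMost E x η → 0ℚ < sum x → α * η ≤ β * sum x
  normalised-bound {x} {η} wx imb T>0 =
    let r , r>0 , rT≡1 = inverse-pos T>0
        y = λ u → r * x u
        wy = record { nonneg      = λ u → *-nonneg (<⇒≤ r>0) (nonneg wx u)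
                    ; off-support = λ u u∉B → trans (cong (r *_) (off-support wx u u∉B)) (*-zeroʳ r) }
        mass = ≤-reflexive (sym (trans (∑-*ˡ r x) rT≡1))
        imb-y = λ t v w → begin
          degree E y t v              ≡⟨ load-*ˡ (λ p → E p t) r x v ⟩
          r * degree E x t v          ≤⟨ *-monoˡ-≤-nonneg (<⇒≤ r>0) (imb t v w) ⟩
          r * (degree E x t w + η)    ≡⟨ *-distribˡ-+ r _ η ⟩
          r * degree E x t w + r * η  ≡⟨ cong (_+ r * η) (sym (load-*ˡ (λ p → E p t) r x w)) ⟩
          degree E y t w + r * η      ∎
    in begin
      α * η                  ≡⟨ sym (trans (regroup (sum x) α r η) (trans (cong (α * η *_) rT≡1) (*-identityʳ _))) ⟩
      sum x * (α * (r * η))  ≤⟨ *-monoˡ-≤-nonneg (<⇒≤ T>0) (bounded y (r * η) wy mass imb-y) ⟩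
      sum x * β              ≡⟨ *-comm (sum x) β ⟩
      β * sum x              ∎
    where
    open ≤-Reasoning
    regroup : ∀ T α r η → T * (α * (r * η)) ≡ α * η * (r * T)
    regroup = solve 4 (λ T α r η → T :* (α :* (r :* η)) := α :* η :* (r :* T)) refl

  robustly-unbalanced : β < 0ℚ → ∃ (RobustlyUnbalanced E B)
  robustly-unbalanced β<0 = K , robust
    where
    inverse : ∃ λ r → 0ℚ < r × r * - β ≡ 1ℚ
    inverse = inverse-pos (neg-antimono-< β<0)
    r : ℚ
    r = proj₁ inverse
    K : ℕ
    K = proj₁ (ι-archimedean (- α * r))
    robust : RobustlyUnbalanced E B K
    robust x η wx η≥0 imb with sum x ℚ.≟ 0ℚ
    ... | yes T≡0 = ≤-trans (≤-reflexive T≡0) (*-nonneg (ι-nonneg K) η≥0)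
    ... | no  T≢0 = begin
      sum x              ≡⟨ sym (trans (cong (_* sum x) (proj₂ (proj₂ inverse))) (*-identityˡ (sum x))) ⟩
      r * - β * sum x    ≡⟨ *-assoc r (- β) (sum x) ⟩
      r * (- β * sum x)  ≤⟨ *-monoˡ-≤-nonneg (<⇒≤ (proj₁ (proj₂ inverse))) (to (difference-⇔ (flip α β (sum x) η))
                              (normalised-bound wx imb (≤∧≢⇒< (∑-nonneg (nonneg wx)) (T≢0 ∘ sym)))) ⟩
      r * (- α * η)      ≡⟨ regroup r α η ⟩
      - α * r * η        ≤⟨ *-monoʳ-≤-nonNeg η {{nonNegative η≥0}} (proj₂ (ι-archimedean (- α * r))) ⟩
      ι K * η            ∎
      where
      open ≤-Reasoning
      flip : ∀ α β T η → β * T - α * η ≡ - α * η - - β * T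
      flip = solve 4 (λ α β T η → β :* T :- α :* η := :- α :* η :- (:- β) :* T) refl
      regroup : ∀ r α η → r * (- α * η) ≡ - α * r * η
      regroup = solve 3 (λ r α η → r :* (:- α :* η) := :- α :* r :* η) refl

balanced-or-robust : (E : Fin n → Edgeᶠ s) (B : Subset n) →
                     BalancedDistributionOn E B ⊎ ∃ (RobustlyUnbalanced E B)
balanced-or-robust E B with feasible-or-bounded system
  where open NearBalanceSystem E B
... | inj₁ (z , sat) =
  let wz , mass , imb = to (NearBalanceSystem.system-⇔ E B) sat
  in inj₁ (z , wz , mass , imbalanceAtMost-0⇒balanced {E = E} imb)
... | inj₂ (α , β , β<0 , bounded) =
  inj₂ (robustly-unbalanced {E = E} {B = B} {α = α}
          (λ x δ wx mass imb → bounded x δ (from (NearBalanceSystem.system-⇔ E B) (wx , mass , imb))) β<0)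

subset-bounded : (f : Subset n → ℕ) → ∃ λ M → ∀ B → f B ℕ.≤ M
subset-bounded {zero}  f = f [] , λ { [] → ℕ.≤-refl }
subset-bounded {suc n} f =
  let M₁ , bound₁ = subset-bounded (f ∘ (inside ∷_))
      M₂ , bound₂ = subset-bounded (f ∘ (outside ∷_))
  in M₁ ℕ.⊔ M₂ , λ { (inside ∷ B) → ℕ.m≤n⇒m≤n⊔o M₂ (bound₁ B) ; (outside ∷ B) → ℕ.m≤n⇒m≤o⊔n M₁ (bound₂ B) }

uniformly-balanced-or-robust : (E : Fin n → Edgeᶠ s) →
                               ∃ λ K → ∀ B → BalancedDistributionOn E B ⊎ RobustlyUnbalanced E B K
uniformly-balanced-or-robust E with subset-bounded (λ B → [ (λ _ → 0) , proj₁ ]′ (balanced-or-robust E B))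
... | K , bounds = K , λ B → weaken B (bounds B)
  where
  weaken : ∀ B → [ (λ _ → 0) , proj₁ ]′ (balanced-or-robust E B) ℕ.≤ K →
           BalancedDistributionOn E B ⊎ RobustlyUnbalanced E B K
  weaken B K_B≤K with balanced-or-robust E B
  ... | inj₁ balanced       = inj₁ balanced
  ... | inj₂ (K_B , robust) = inj₂ (RobustlyUnbalanced-mono {E = E} K_B≤K robust)

-- The complete hypergraph with sides a

∏ : Vec ℕ k → ℕ
∏ []      = 1
∏ (x ∷ a) = x ℕ.* ∏ a

decode : (a : Vec ℕ k) → Fin (∏ a) → Edge a
decode (x ∷ a) u zero    = proj₁ (remQuot {x} (∏ a) u)
decode (x ∷ a) u (suc t) = decode a (proj₂ (remQuot {x} (∏ a) u)) t

encode : (a : Vec ℕ k) → Edge a → Fin (∏ a)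
encode []      e = zero
encode (x ∷ a) e = combine (e zero) (encode a (e ∘ suc))

decode-encode : ∀ (a : Vec ℕ k) e t → decode a (encode a e) t ≡ e t
decode-encode (x ∷ a) e zero    = cong proj₁ (remQuot-combine (e zero) (encode a (e ∘ suc)))
decode-encode (x ∷ a) e (suc t) =
  trans (cong (λ u → decode a u t) (cong proj₂ (remQuot-combine (e zero) (encode a (e ∘ suc)))))
        (decode-encode a (e ∘ suc) t)

encode-cong : ∀ (a : Vec ℕ k) {e e′ : Edge a} → (∀ t → e t ≡ e′ t) → encode a e ≡ encode a e′
encode-cong []      e≗e′ = refl
encode-cong (x ∷ a) e≗e′ = cong₂ combine (e≗e′ zero) (encode-cong a (e≗e′ ∘ suc))

encode-decode : ∀ (a : Vec ℕ k) u → encode a (decode a u) ≡ u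
encode-decode []      zero = refl
encode-decode (x ∷ a) u    =
  trans (cong (combine (proj₁ (remQuot {x} (∏ a) u))) (encode-decode a (proj₂ (remQuot {x} (∏ a) u))))
        (combine-remQuot {x} (∏ a) u)

decode-distinct : ∀ (a : Vec ℕ k) {u u′} → u ≢ u′ → Distinct {b = a} (decode a u) (decode a u′)
decode-distinct a {u} {u′} u≢u′ =
  ¬∀⟶∃¬ _ (λ t → decode a u t ≡ decode a u′ t) (λ t → decode a u t ≟ decode a u′ t)
    λ decode≗ → u≢u′ (trans (sym (encode-decode a u)) (trans (encode-cong a decode≗) (encode-decode a u′)))

sumℚ-tabulate : ∀ (h : Vector ℚ n) → sumℚ (tabulate h) ≡ sum h
sumℚ-tabulate {zero}  h = refl
sumℚ-tabulate {suc n} h = cong (_+_ (h zero)) (sumℚ-tabulate (h ∘ suc))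

deg≡degree : ∀ {b : Vec ℕ k} (H : Hypergraph b) f t v → deg H f t v ≡ degree (edgeAt H) f t v
deg≡degree H f t v = trans (cong sumℚ (List.map-tabulate id h))
                           (trans (sumℚ-tabulate h) (sum-cong-≗ λ p → if-⌊⌋ (edgeAt H p t ≟ v) (f p)))
  where
  h : Vector ℚ (List.length (edges H))
  h p = if ⌊ edgeAt H p t ≟ v ⌋ then f p else 0ℚ

Balanced⇒IsBalanced : ∀ {b : Vec ℕ k} (H : Hypergraph b) {f} → Balanced H f → IsBalanced (edgeAt H) f
Balanced⇒IsBalanced H {f} bal t v w = trans (sym (deg≡degree H f t v)) (trans (bal t v w) (deg≡degree H f t w))

∑-lookup : ∀ {A : Set} (xs : List A) (G : A → ℚ) →
           ∑[ p < List.length xs ] G (List.lookup xs p) ≡ sumℚ (List.map G xs)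
∑-lookup []       G = refl
∑-lookup (x ∷ xs) G = cong (_+_ (G x)) (∑-lookup xs G)

members : Subset n → List (Fin n)
members []            = []
members (inside ∷ B)  = zero ∷ List.map suc (members B)
members (outside ∷ B) = List.map suc (members B)

members-∈ : (B : Subset n) → All (_∈ B) (members B)
members-∈ []            = []
members-∈ (inside ∷ B)  = Vec.here ∷ All.map⁺ (All.map Vec.there (members-∈ B))
members-∈ (outside ∷ B) = All.map⁺ (All.map Vec.there (members-∈ B))

members-unique : (B : Subset n) → Unique (members B)
members-unique []            = []
members-unique (inside ∷ B)  = All.map⁺ (All.universal (λ _ ()) _) ∷ Unique.map⁺ suc-injective (members-unique B)
members-unique (outside ∷ B) = Unique.map⁺ suc-injective (members-unique B)

sumℚ-members : ∀ (B : Subset n) h → sumℚ (List.map h (members B)) ≡ ∑[ u < n ] (𝟙 (u ∈? B) * h u)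
sumℚ-members []            h = refl
sumℚ-members (inside ∷ B)  h =
  cong₂ _+_ (sym (*-identityˡ (h zero)))
            (trans (cong sumℚ (sym (List.map-∘ (members B)))) (sumℚ-members B (h ∘ suc)))
sumℚ-members (outside ∷ B) h =
  trans (trans (cong sumℚ (sym (List.map-∘ (members B)))) (sumℚ-members B (h ∘ suc)))
        (sym (trans (cong (_+ ∑[ u < _ ] (𝟙 (u ∈? B) * h (suc u))) (*-zeroˡ (h zero))) (+-identityˡ _)))

spanned : (a : Vec ℕ k) → Subset (∏ a) → Hypergraph a
spanned a B = hypergraph (List.map (decode a) (members B))
                         (AllPairs.map⁺ (AllPairs.map (decode-distinct a) (members-unique B)))

∑-spanned : ∀ (a : Vec ℕ k) B (G : Edge a → ℚ) →
            ∑[ p < List.length (edges (spanned a B)) ] G (edgeAt (spanned a B) p) ≡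
            ∑[ u < ∏ a ] (𝟙 (u ∈? B) * G (decode a u))
∑-spanned a B G = trans (∑-lookup (edges (spanned a B)) G)
                        (trans (cong sumℚ (sym (List.map-∘ (members B)))) (sumℚ-members B (G ∘ decode a)))

spanned-fractionallyBalanced : ∀ (a : Vec ℕ k) {B z} → WeightingOn B z → 1ℚ ≤ sum z → IsBalanced (decode a) z →
                               FractionallyBalanced (spanned a B)
spanned-fractionallyBalanced a {B} {z} wz mass bal = f , (λ p → nonneg wz _) , nonzero , balanced
  where
  H : Hypergraph a
  H = spanned a B
  f : Weight H
  f p = z (encode a (edgeAt H p))
  on-support : ∀ u → 𝟙 (u ∈? B) * z (encode a (decode a u)) ≡ z u
  on-support u with u ∈? B
  ... | yes _  = trans (*-identityˡ (z (encode a (decode a u)))) (cong z (encode-decode a u))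
  ... | no u∉B = trans (*-zeroˡ (z (encode a (decode a u)))) (sym (off-support wz u u∉B))
  ∑f≡∑z : sum f ≡ sum z
  ∑f≡∑z = trans (∑-spanned a B (z ∘ encode a)) (sum-cong-≗ on-support)
  nonzero : ∃ λ p → f p ≢ 0ℚ
  nonzero = ∑-≢0 f λ ∑f≡0 → <⇒≢ (<-≤-trans (positive⁻¹ 1ℚ) mass) (sym (trans (sym ∑f≡∑z) ∑f≡0))
  degree≡ : ∀ t v → deg H f t v ≡ degree (decode a) z t v
  degree≡ t v = trans (deg≡degree H f t v)
    (trans (∑-spanned a B (λ e → 𝟙 (e t ≟ v) * z (encode a e))) (sum-cong-≗ λ u →
      trans (x∙yz≈y∙xz (𝟙 (u ∈? B)) (𝟙 (decode a u t ≟ v)) _) (cong (_*_ (𝟙 (decode a u t ≟ v))) (on-support u))))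
  balanced : Balanced H f
  balanced t v w = trans (degree≡ t v) (trans (bal t v w) (sym (degree≡ t w)))

MatchingIn : (a : Vec ℕ k) → Subset (∏ a) → ℕ → Set
MatchingIn a B m =
  ∃ λ (us : Fin m → Fin (∏ a)) → (∀ i → us i ∈ B) × (∀ i j → i ≢ j → Disjoint {b = a} (decode a (us i)) (decode a (us j)))

spanned-matching : ∀ (a : Vec ℕ k) B → HasMatching (spanned a B) m → MatchingIn a B m
spanned-matching a B (g , matching) = us , us∈B , disjoint
  where
  origin : ∀ i → ∃ λ u → u ∈ˡ members B × edgeAt (spanned a B) (g i) ≡ decode a u
  origin i = ∈-map⁻ (decode a) (∈-lookup (g i))
  us : _ → Fin (∏ a)
  us i = proj₁ (origin i)
  us∈B : ∀ i → us i ∈ B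
  us∈B i = All.lookup (members-∈ B) (proj₁ (proj₂ (origin i)))
  disjoint : ∀ i j → i ≢ j → Disjoint {b = a} (decode a (us i)) (decode a (us j))
  disjoint i j i≢j = subst₂ (Disjoint {b = a}) (proj₂ (proj₂ (origin i))) (proj₂ (proj₂ (origin j))) (proj₂ (matching i j i≢j))

balanced-distribution⇒matching : ∀ {a : Vec ℕ k} {B} → a →BM m → BalancedDistributionOn (decode a) B → MatchingIn a B m
balanced-distribution⇒matching {a = a} {B} a→m (z , wz , mass , bal) =
  spanned-matching a B (a→m (spanned a B) (spanned-fractionallyBalanced a wz mass bal))

subsetOf : ∀ {P : Fin n → Set} → (∀ u → Dec (P u)) → Subset n
subsetOf P? = Vec.tabulate (λ u → does (P? u))

∈-subsetOf : ∀ {P : Fin n → Set} (P? : ∀ u → Dec (P u)) u → u ∈ subsetOf P? ⇔ P u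
∈-subsetOf P? u = mk⇔ (decided (P? u) ∘ trans (sym (Vec.lookup∘tabulate _ u)) ∘ Vec.[]=⇒lookup)
                      (λ p → Vec.lookup⇒[]= u _ (trans (Vec.lookup∘tabulate _ u) (yes-does (P? u) p)))
  where
  decided : (Q? : Dec Q) → does Q? ≡ true → Q
  decided (yes q) _  = q
  decided (no _)  ()
  yes-does : (Q? : Dec Q) → Q → does Q? ≡ true
  yes-does (yes _) _ = refl
  yes-does (no ¬q) q = ⊥-elim (¬q q)

count-≤-cover : ∀ {P : Fin n → Set} (P? : ∀ v → Dec (P v)) (cover : Fin k → Fin n) →
                (∀ v → P v → ∃ λ j → cover j ≡ v) → ∑[ v < n ] 𝟙 (P? v) ≤ ι k
count-≤-cover {k = k} P? cover covered = begin
  ∑[ v < _ ] 𝟙 (P? v)                ≤⟨ ∑-mono-≤ pointwise ⟩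
  ∑[ v < _ ] load cover (λ _ → 1ℚ) v ≡⟨ ∑-load cover (λ _ → 1ℚ) ⟩
  ∑[ j < k ] 1ℚ                      ≡⟨ ∑-const k 1ℚ ⟩
  ι k * 1ℚ                           ≡⟨ *-identityʳ (ι k) ⟩
  ι k                                ∎
  where
  open ≤-Reasoning
  1≥0 : Fin k → 0ℚ ≤ 1ℚ
  1≥0 _ = <⇒≤ (positive⁻¹ 1ℚ)
  pointwise : ∀ v → 𝟙 (P? v) ≤ load cover (λ _ → 1ℚ) v
  pointwise v with P? v
  ... | no _  = load-nonneg cover 1≥0 v
  ... | yes p with covered v p
  ...   | j , cover-j≡v =
    ≤-trans (≤-reflexive (sym (trans (cong (_* 1ℚ) (𝟙-yes (cover j ≟ v) cover-j≡v)) (*-identityˡ 1ℚ))))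
            (≤-∑ (λ i → *-nonneg (𝟙-nonneg (cover i ≟ v)) (1≥0 i)) j)

fresh-option : ∀ {P : Fin n → Set} (P? : ∀ v → Dec (P v)) (used : Fin k → Fin n) → k ℕ.< m →
               ι m ≤ ∑[ v < n ] 𝟙 (P? v) → ∃ λ v → P v × ∀ j → used j ≢ v
fresh-option {k = k} {m = m} {P = P} P? used k<m many with any? (λ v → P? v ×-dec all? (λ j → ¬? (used j ≟ v)))
... | yes (v , p , fresh) = v , p , fresh
... | no none = ⊥-elim (1+q≰q (ι k) (begin
  ι (suc k)            ≤⟨ ι-mono k<m ⟩
  ι m                  ≤⟨ many ⟩
  ∑[ v < _ ] 𝟙 (P? v)  ≤⟨ count-≤-cover P? used covered ⟩
  ι k                  ∎))
  where
  open ≤-Reasoning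
  covered : ∀ v → P v → ∃ λ j → used j ≡ v
  covered v p with any? (λ j → used j ≟ v)
  ... | yes used-v = used-v
  ... | no unused  = ⊥-elim (none (v , p , λ j used-j≡v → unused (j , used-j≡v)))

distinct-choices : ∀ {R : Fin k → Fin n → Set} (R? : ∀ i v → Dec (R i v)) → k ℕ.≤ m →
                   (∀ i → ι m ≤ ∑[ v < n ] 𝟙 (R? i v)) →
                   ∃ λ (vs : Fin k → Fin n) → (∀ i → R i (vs i)) × (∀ i j → vs i ≡ vs j → i ≡ j)
distinct-choices {zero}          R? _   _    = (λ ()) , (λ ()) , (λ ())
distinct-choices {suc k} {R = R} R? k<m many with distinct-choices (R? ∘ suc) (ℕ.<⇒≤ k<m) (many ∘ suc)
... | vs , R-vs , vs-injective with fresh-option (R? zero) vs k<m (many zero)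
... | v , R-v , fresh = choice , R-choice , choice-injective
  where
  choice : Fin (suc k) → Fin _
  choice zero    = v
  choice (suc i) = vs i
  R-choice : ∀ i → R i (choice i)
  R-choice zero    = R-v
  R-choice (suc i) = R-vs i
  choice-injective : ∀ i j → choice i ≡ choice j → i ≡ j
  choice-injective zero    zero    _  = refl
  choice-injective zero    (suc j) eq = ⊥-elim (fresh j (sym eq))
  choice-injective (suc i) zero    eq = ⊥-elim (fresh i eq)
  choice-injective (suc i) (suc j) eq = cong suc (vs-injective i j eq)

Joint : (φ : Fin n → Fin m) (ψ : Fin n → Fin l) → Fin m → Fin l → Set
Joint φ ψ u v = ∃ λ p → φ p ≡ u × ψ p ≡ v

joint? : ∀ (φ : Fin n → Fin m) (ψ : Fin n → Fin l) u v → Dec (Joint φ ψ u v)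
joint? φ ψ u v = any? (λ p → φ p ≟ u ×-dec ψ p ≟ v)

load-≤-fibres : ∀ (φ : Fin n → Fin m) (ψ : Fin n → Fin l) {x c} → (∀ p → 0ℚ ≤ x p) → (∀ v → load ψ x v ≤ c) →
                ∀ u → load φ x u ≤ c * ∑[ v < l ] 𝟙 (joint? φ ψ u v)
load-≤-fibres {l = l} φ ψ {x} {c} x≥0 load≤c u = begin
  load φ x u                           ≡⟨ sym (∑-load ψ fibre) ⟩
  ∑[ v < l ] load ψ fibre v            ≤⟨ ∑-mono-≤ pointwise ⟩
  ∑[ v < l ] (c * 𝟙 (joint? φ ψ u v))  ≡⟨ ∑-*ˡ c (λ v → 𝟙 (joint? φ ψ u v)) ⟩
  c * ∑[ v < l ] 𝟙 (joint? φ ψ u v)    ∎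
  where
  open ≤-Reasoning
  fibre : Vector ℚ _
  fibre p = 𝟙 (φ p ≟ u) * x p
  vanishes : ∀ v → ¬ Joint φ ψ u v → ∀ p → 𝟙 (ψ p ≟ v) * fibre p ≡ 0ℚ
  vanishes v no-joint p with φ p ≟ u | ψ p ≟ v
  ... | yes φp≡u | yes ψp≡v = ⊥-elim (no-joint (p , φp≡u , ψp≡v))
  ... | φ?       | no _     = *-zeroˡ (𝟙 φ? * x p)
  ... | no _     | yes _    = trans (*-identityˡ _) (*-zeroˡ (x p))
  pointwise : ∀ v → load ψ fibre v ≤ c * 𝟙 (joint? φ ψ u v)
  pointwise v with joint? φ ψ u v
  ... | yes _   = ≤-trans (∑-mono-≤ λ p → *-monoˡ-≤-nonneg (𝟙-nonneg (ψ p ≟ v)) (𝟙*-≤ (φ p ≟ u) (x≥0 p)))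
                          (≤-trans (load≤c v) (≤-reflexive (sym (*-identityʳ c))))
  ... | no none = ≤-reflexive (trans (∑-zero (vanishes v none)) (sym (*-zeroʳ c)))

-- Adding a side

edgeInit : ∀ {d N} (a : Vec ℕ d) → Edge (a ∷ʳ N) → Edge a
edgeInit (_ ∷ a) e zero    = e zero
edgeInit (_ ∷ a) e (suc t) = edgeInit a (e ∘ suc) t

edgeLast : ∀ {d N} (a : Vec ℕ d) → Edge (a ∷ʳ N) → Fin N
edgeLast []      e = e zero
edgeLast (_ ∷ a) e = edgeLast a (e ∘ suc)

disjoint-∷ʳ : ∀ {d N} (a : Vec ℕ d) {e e′ : Edge (a ∷ʳ N)} →
              Disjoint {b = a} (edgeInit a e) (edgeInit a e′) → edgeLast a e ≢ edgeLast a e′ →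
              Disjoint {b = a ∷ʳ N} e e′
disjoint-∷ʳ []      _             last≢ zero    = last≢
disjoint-∷ʳ (_ ∷ a) init-disjoint last≢ zero    = init-disjoint zero
disjoint-∷ʳ (_ ∷ a) init-disjoint last≢ (suc t) = disjoint-∷ʳ a (init-disjoint ∘ suc) last≢ t

edgeInit-balanced : ∀ {d N} (a : Vec ℕ d) (E : Fin n → Edge (a ∷ʳ N)) {x} →
                    IsBalanced E x → IsBalanced (edgeInit a ∘ E) x
edgeInit-balanced (_ ∷ a) E bal zero    = bal zero
edgeInit-balanced (_ ∷ a) E bal (suc t) = edgeInit-balanced a (λ p → E p ∘ suc) (bal ∘ suc) t

edgeLast-balanced : ∀ {d N} (a : Vec ℕ d) (E : Fin n → Edge (a ∷ʳ N)) {x} →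
                    IsBalanced E x → ∀ v w → load (edgeLast a ∘ E) x v ≡ load (edgeLast a ∘ E) x w
edgeLast-balanced []      E bal = bal zero
edgeLast-balanced (_ ∷ a) E bal = edgeLast-balanced a (λ p → E p ∘ suc) (bal ∘ suc)

module Extension {d : ℕ} (a : Vec ℕ d) (m : ℕ) where

  -- Opaque, so that the type checker never runs the Fourier–Motzkin elimination behind K.
  opaque
    K : ℕ
    K = proj₁ (uniformly-balanced-or-robust (decode a))

    uniformly : ∀ B → BalancedDistributionOn (decode a) B ⊎ RobustlyUnbalanced (decode a) B K
    uniformly = proj₂ (uniformly-balanced-or-robust (decode a))

  N : ℕ
  N = suc (suc K ℕ.* (∏ a ℕ.* m))

  module _ (H : Hypergraph (a ∷ʳ N)) (f : Weight H) (f≥0 : ∀ p → 0ℚ ≤ f p) (bal : IsBalanced (edgeAt H) f) where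

    φ : Fin (List.length (edges H)) → Fin (∏ a)
    φ p = encode a (edgeInit a (edgeAt H p))

    ψ : Fin (List.length (edges H)) → Fin N
    ψ p = edgeLast a (edgeAt H p)

    g : Vector ℚ (∏ a)
    g = load φ f

    c : ℚ
    c = load ψ f zero

    lifts : Fin (∏ a) → ℚ
    lifts u = ∑[ v < N ] 𝟙 (joint? φ ψ u v)

    thick? : ∀ u → Dec (ι m ≤ lifts u)
    thick? u = ι m ≤? lifts u

    B : Subset (∏ a)
    B = subsetOf thick?

    x y : Vector ℚ (∏ a)
    x u = 𝟙 (u ∈? B) * g u
    y u = 𝟙 (¬? (u ∈? B)) * g u

    g-balanced : IsBalanced (decode a) g
    g-balanced t v w = trans (projected v) (trans (edgeInit-balanced a (edgeAt H) bal t v w) (sym (projected w)))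
      where
      projected : ∀ v → degree (decode a) g t v ≡ degree (edgeInit a ∘ edgeAt H) f t v
      projected v = trans (load-∘ φ (λ u → decode a u t) f v)
                          (load-cong (λ p → decode-encode a (edgeInit a (edgeAt H p)) t) f v)

    last-degree : ∀ v → load ψ f v ≡ c
    last-degree v = edgeLast-balanced a (edgeAt H) bal v zero

    total : sum f ≡ ι N * c
    total = trans (sym (∑-load ψ f)) (trans (sum-cong-≗ last-degree) (∑-const N c))

    g≡x+y : ∀ u → g u ≡ x u + y u
    g≡x+y u = sym (trans (sym (*-distribʳ-+ (g u) (𝟙 (u ∈? B)) (𝟙 (¬? (u ∈? B)))))
                         (trans (cong (_* g u) (𝟙+𝟙¬ (u ∈? B))) (*-identityˡ (g u))))

    g≥0 : ∀ u → 0ℚ ≤ g u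
    g≥0 = load-nonneg φ f≥0

    c≥0 : 0ℚ ≤ c
    c≥0 = load-nonneg ψ f≥0 zero

    x-weighting : WeightingOn B x
    x-weighting = record
      { nonneg      = λ u → *-nonneg (𝟙-nonneg (u ∈? B)) (g≥0 u)
      ; off-support = λ u u∉B → trans (cong (_* g u) (𝟙-no (u ∈? B) u∉B)) (*-zeroˡ (g u)) }

    y≥0 : ∀ u → 0ℚ ≤ y u
    y≥0 u = *-nonneg (𝟙-nonneg (¬? (u ∈? B))) (g≥0 u)

    y≤ : ∀ u → y u ≤ ι m * c
    y≤ u with u ∈? B
    ... | yes _  = ≤-trans (≤-reflexive (*-zeroˡ (g u))) (*-nonneg (ι-nonneg m) c≥0)
    ... | no u∉B = begin
      1ℚ * g u     ≡⟨ *-identityˡ (g u) ⟩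
      g u          ≤⟨ load-≤-fibres φ ψ f≥0 (≤-reflexive ∘ last-degree) u ⟩
      c * lifts u  ≤⟨ *-monoˡ-≤-nonneg c≥0 (<⇒≤ (≰⇒> (u∉B ∘ from (∈-subsetOf thick? u)))) ⟩
      c * ι m      ≡⟨ *-comm c (ι m) ⟩
      ι m * c      ∎
      where open ≤-Reasoning

    ∑y≤ : sum y ≤ ι (∏ a) * (ι m * c)
    ∑y≤ = ≤-trans (∑-mono-≤ y≤) (≤-reflexive (∑-const (∏ a) (ι m * c)))

    ∑x+∑y : sum x + sum y ≡ sum f
    ∑x+∑y = trans (sym (∑-distrib-+ x y)) (trans (sum-cong-≗ (sym ∘ g≡x+y)) (∑-load φ f))

    not-robust : 0ℚ < sum f → ¬ RobustlyUnbalanced (decode a) B K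
    not-robust W>0 robust = <-irrefl refl (<-≤-trans W>0 W≤0)
      where
      open ≤-Reasoning
      X : ℚ
      X = ι (suc K ℕ.* (∏ a ℕ.* m))
      squeeze : (1ℚ + X) * c ≤ X * c
      squeeze = begin
        (1ℚ + X) * c                       ≡⟨ sym total ⟩
        sum f                              ≡⟨ sym ∑x+∑y ⟩
        sum x + sum y                      ≤⟨ +-monoˡ-≤ (sum y) (robust x (sum y) x-weighting (∑-nonneg y≥0)
                                                (imbalance-of-part {E = decode a} g≡x+y y≥0 g-balanced)) ⟩
        ι K * sum y + sum y                ≡⟨ k*s+s (ι K) (sum y) ⟩
        ι (suc K) * sum y                  ≤⟨ *-monoˡ-≤-nonneg (ι-nonneg (suc K)) ∑y≤ ⟩
        ι (suc K) * (ι (∏ a) * (ι m * c))  ≡⟨ regroup (ι (suc K)) (ι (∏ a)) (ι m) c ⟩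
        ι (suc K) * (ι (∏ a) * ι m) * c    ≡⟨ cong (_* c) (sym (trans (ι-* (suc K) (∏ a ℕ.* m))
                                                                      (cong (_*_ (ι (suc K))) (ι-* (∏ a) m)))) ⟩
        X * c                              ∎
        where
        k*s+s : ∀ k s → k * s + s ≡ (1ℚ + k) * s
        k*s+s = solve 2 (λ k s → k :* s :+ s := (con 1ℚ :+ k) :* s) refl
        regroup : ∀ k p q c → k * (p * (q * c)) ≡ k * (p * q) * c
        regroup = solve 4 (λ k p q c → k :* (p :* (q :* c)) := k :* (p :* q) :* c) refl
      c≤0 : c ≤ 0ℚ
      c≤0 = to (difference-⇔ (cancel X c)) squeeze
        where
        cancel : ∀ X c → X * c - (1ℚ + X) * c ≡ 0ℚ - c
        cancel = solve 2 (λ X c → X :* c :- (con 1ℚ :+ X) :* c := con 0ℚ :- c) refl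
      W≤0 : sum f ≤ 0ℚ
      W≤0 = begin
        sum f     ≡⟨ total ⟩
        ι N * c   ≤⟨ *-monoˡ-≤-nonneg (ι-nonneg N) c≤0 ⟩
        ι N * 0ℚ  ≡⟨ *-zeroʳ (ι N) ⟩
        0ℚ        ∎

    lift-matching : MatchingIn a B m → HasMatching H m
    lift-matching (us , us∈B , disjoint) =
      p , λ i j i≢j → p-distinct i j i≢j , disjoint-∷ʳ a (init-disjoint i j i≢j) (last-distinct i j i≢j)
      where
      choice : ∃ λ (vs : Fin m → Fin N) → (∀ i → Joint φ ψ (us i) (vs i)) × (∀ i j → vs i ≡ vs j → i ≡ j)
      choice = distinct-choices (λ i v → joint? φ ψ (us i) v) ℕ.≤-refl (λ i → to (∈-subsetOf thick? (us i)) (us∈B i))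
      p : Fin m → Fin (List.length (edges H))
      p i = proj₁ (proj₁ (proj₂ choice) i)
      φp≡us : ∀ i → φ (p i) ≡ us i
      φp≡us i = proj₁ (proj₂ (proj₁ (proj₂ choice) i))
      ψp≡vs : ∀ i → ψ (p i) ≡ proj₁ choice i
      ψp≡vs i = proj₂ (proj₂ (proj₁ (proj₂ choice) i))
      last-distinct : ∀ i j → i ≢ j → ψ (p i) ≢ ψ (p j)
      last-distinct i j i≢j eq = i≢j (proj₂ (proj₂ choice) i j (trans (sym (ψp≡vs i)) (trans eq (ψp≡vs j))))
      p-distinct : ∀ i j → i ≢ j → p i ≢ p j
      p-distinct i j i≢j eq = last-distinct i j i≢j (cong ψ eq)
      init≡ : ∀ i t → decode a (us i) t ≡ edgeInit a (edgeAt H (p i)) t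
      init≡ i t = trans (cong (λ u → decode a u t) (sym (φp≡us i))) (decode-encode a (edgeInit a (edgeAt H (p i))) t)
      init-disjoint : ∀ i j → i ≢ j → Disjoint {b = a} (edgeInit a (edgeAt H (p i))) (edgeInit a (edgeAt H (p j)))
      init-disjoint i j i≢j t eq = disjoint i j i≢j t (trans (init≡ i t) (trans eq (sym (init≡ j t))))

    matching : a →BM m → 0ℚ < sum f → HasMatching H m
    matching a→m W>0 with uniformly B
    ... | inj₁ balanced = lift-matching (balanced-distribution⇒matching a→m balanced)
    ... | inj₂ robust   = ⊥-elim (not-robust W>0 robust)

theorem5p1 : (d : ℕ) → 1 ℕ.≤ d → (a : Vec ℕ d) → Positive a → (m : ℕ) → 0 ℕ.< m →
    a →BM m → Σ ℕ (λ a' → (0 ℕ.< a') × ((a ∷ʳ a') →BM m))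
theorem5p1 d _ a _ m _ a→m = N , ℕ.s≤s ℕ.z≤n , λ H (f , f≥0 , (p , fp≢0) , bal) →
  matching H f f≥0 (Balanced⇒IsBalanced H bal) a→m (∑-pos f≥0 p fp≢0)
  where open Extension a m
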